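{- Let $p$ be an odd prime, $k$ an algebraically closed field of characteristic $p$, and $d=p^2+1$. Let $X\to\mathbb P^1$ be the Artin–Schreier cover defined by $y^p-y=-x^{d}-x^{d/2+p}$. Let $0\le k'<\frac{p-1}{2}$ and $0\le l\le \frac{d(p/2-1-k')}{p}$ be integers. Then there exists $y^mx^n\,dx\in\mathcal B_X$ with $m<\frac{p-1}{2}$ such that the largest term of $\mathcal C_X(y^mx^n\,dx)$ (when written in the basis $\mathcal B_X$, with respect to the order below) is $y^{k'}x^{l}\,dx$.
   Context: An Artin–Schreier cover is a $\mathbb Z/p\mathbb Z$-Galois cover $X\to\mathbb P^1$ of smooth projective connected curves over $k$, given by an equation $y^p-y=f(x)$. For $f\in k[x]$ of degree $d$ prime to $p$, the set $\mathcal B_X=\{y^ix^j\,dx:\ 0\le i\le p-2,\ 0\le j\le \lceil (p-i-1)d/p\rceil-2\}$ is a $k$-basis of $H^0(X,\Omega^1_X)$. $\mathcal C_X:H^0(X,\Omega^1_X)\to H^0(X,\Omega^1_X)$ is the Cartier operator, the $p^{ -1}$-semilinear map with $\mathcal C_X(f^p\alpha+\beta)=f\,\mathcal C_X(\alpha)+\mathcal C_X(\beta)$, $\mathcal C_X(x^{p-1}dx)=dx$, and $\mathcal C_X(x^ndx)=0$ for $n\not\equiv -1\pmod p$. $\mathcal B_X$ is ordered lexicographically with $y>x$: $y^ix^jdx>y^ax^bdx$ iff $i>a$, or $i=a$ and $j>b$. -}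

module Defs where

open import Data.Nat using (ℕ; zero; suc; _+_; _*_; _∸_; _/_; _≤_; _<_; _≟_)
open import Data.Nat.Combinatorics using (_C_)
open import Data.Nat.Divisibility using (_∣_)
open import Data.Bool using (Bool; true; false; if_then_else_; _∨_)
open import Data.Product using (_×_)
open import Data.Sum using (_⊎_)
open import Relation.Nullary using (¬_)
open import Relation.Nullary.Decidable using (⌊_⌋)
open import Relation.Binary.PropositionalEquality using (_≡_)

-- All objects in the statement are defined over F_p (the equation has
-- coefficients in F_p), so coefficients are natural numbers read modulo p.

Poly : Set
Poly = ℕ → ℕ

sumBelow : (ℕ → ℕ) → ℕ → ℕ
sumBelow h zero    = 0
sumBelow h (suc n) = sumBelow h n + h n

mulP : Poly → Poly → Poly
mulP f g n = sumBelow (λ i → f i * g (n ∸ i)) (suc n)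

oneP : Poly
oneP e = if ⌊ e ≟ 0 ⌋ then 1 else 0

powP : Poly → ℕ → Poly
powP f zero    = oneP
powP f (suc r) = mulP f (powP f r)

xPow : ℕ → Poly
xPow n e = if ⌊ e ≟ n ⌋ then 1 else 0

dd : ℕ → ℕ
dd p = p * p + 1

-- -f(x) = x^d + x^(d/2 + p), i.e. f = -x^d - x^(d/2+p)
negF : ℕ → Poly
negF p e = if ⌊ e ≟ dd p ⌋ ∨ ⌊ e ≟ dd p / 2 + p ⌋ then 1 else 0

-- Cartier operator on F_p[x] dx:  C(x^(p-1) dx) = dx, C(x^e dx) = 0 for
-- e ≢ -1 mod p, and C(g^p h dx) = g C(h dx); on F_p coefficients a^(1/p) = a.
cartierX : ℕ → Poly → Poly
cartierX p h c = h (p * c + (p ∸ 1))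

-- Differentials  Σ coeff(i,j) y^i x^j dx, as a coefficient function.
Diff : Set
Diff = ℕ → ℕ → ℕ

-- Since y = y^p - f, y^m = Σ_a (m choose a) y^(pa) (-f)^(m-a), hence
--   C(y^m x^n dx) = Σ_a (m choose a) y^a C((-f)^(m-a) x^n dx).
-- Result: coefficient of y^a x^c dx.
cartier : ℕ → ℕ → ℕ → Diff
cartier p m n a c =
  if ⌊ Data.Nat._≤?_ a m ⌋
  then (m C a) * cartierX p (mulP (powP (negF p) (m ∸ a)) (xPow n)) c
  else 0

-- ⌈ a / b ⌉ for b > 0
ceilDiv : ℕ → ℕ → ℕ
ceilDiv a b = (a + (b ∸ 1)) / suc (b ∸ 1)

InBasis : ℕ → ℕ → ℕ → Set
InBasis p i j = (i ≤ p ∸ 2) × (j + 2 ≤ ceilDiv ((p ∸ i ∸ 1) * dd p) p)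

LexLeq : ℕ → ℕ → ℕ → ℕ → Set
LexLeq a b i j = (a < i) ⊎ ((a ≡ i) × (b ≤ j))

LargestTerm : ℕ → Diff → ℕ → ℕ → Set
LargestTerm p ω i j =
  (¬ (p ∣ ω i j)) × (∀ a b → ¬ (p ∣ ω a b) → LexLeq a b i j)

{-# OPTIONS --safe #-}
-- Write p = 2s + 1, d = p² + 1 and e = d/2 + p, so that −f = x^d + x^e.  The coefficient of
-- y^a x^b dx in C(y^m x^n dx) is (m choose a) times the coefficient of x^(pb + p − 1 − n) in
-- (x^d + x^e)^(m − a), whose exponents are the numbers i d + w e with i + w = m − a.
-- Divide N = pl + p − 1 by d, N = J d + r.  If r < e take (m, n) = (k' + J, r), using the term
-- x^(J d) of (x^d + x^e)^J, with coefficient 1; otherwise take (m, n) = (k' + J + 1, r − e),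
-- using the term x^(J d + e) of (x^d + x^e)^(J + 1), with coefficient J + 1.  As d ≡ 1 and
-- 2e ≡ 1 modulo p, twice an exponent i d + w e has residue 2i + w; for a nonzero term y^a x^b
-- with a ≥ k' this residue is below p and, together with i + w ≤ m − k', forces a = k' and b = l.
-- The hypothesis on l keeps J small enough for (m, n) to lie in the basis with m < (p − 1)/2.
module Submission where

open import Defs
open import Data.Nat.Primality using (Prime; euclidsLemma; prime⇒nonTrivial; prime⇒irreducible)
open import Data.Product using (Σ; _×_; _,_; ∃₂; proj₁; proj₂)
open import Relation.Nullary using (¬_; Dec; yes; no; contradiction)
open import Relation.Binary.PropositionalEquality
  using (_≡_; _≢_; refl; sym; trans; cong; cong₂; subst; module ≡-Reasoning)

open import Data.Bool using (if_then_else_)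
open import Data.List using (_∷_; [])
open import Data.Nat
open import Data.Nat.Combinatorics using (_C_; nCk≡n!/k![n-k]!; k![n∸k]!∣n!)
open import Data.Nat.Divisibility using (_∣_; divides; _∣0; ∣⇒≤; ∣1⇒≡1; ∣m⇒∣m*n; >⇒∤)
open import Data.Nat.DivMod
  using (_/_; _%_; m≡m%n+[m/n]*n; m%n<n; m/n*n≡m; m*n/n≡m; /-monoˡ-≤; m<n⇒m%n≡m; [m+kn]%n≡m%n)
open import Data.Nat.Properties
open import Algebra.Properties.CommutativeSemigroup +-commutativeSemigroup using (interchange; x∙yz≈y∙xz)
open import Data.Nat.Tactic.RingSolver using (solve; solve-∀)
open import Data.Sum using (inj₁; inj₂)
open import Relation.Nullary.Decidable using (⌊_⌋)

if-yes : ∀ {a b} {A : Set a} {B : Set b} (a? : Dec A) {x y : B} → A →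
  (if ⌊ a? ⌋ then x else y) ≡ x
if-yes (yes _) _ = refl
if-yes (no ¬a) a = contradiction a ¬a

if-no : ∀ {a b} {A : Set a} {B : Set b} (a? : Dec A) {x y : B} → ¬ A →
  (if ⌊ a? ⌋ then x else y) ≡ y
if-no (yes a) ¬a = contradiction a ¬a
if-no (no _)  _  = refl

-- Polynomials as coefficient functions

sumBelow-cong : ∀ {f g} N → (∀ {i} → i < N → f i ≡ g i) → sumBelow f N ≡ sumBelow g N
sumBelow-cong zero    f≗g = refl
sumBelow-cong (suc N) f≗g =
  cong₂ _+_ (sumBelow-cong N (λ i<N → f≗g (m<n⇒m<1+n i<N))) (f≗g ≤-refl)

sumBelow-+ : ∀ f g N → sumBelow (λ i → f i + g i) N ≡ sumBelow f N + sumBelow g N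
sumBelow-+ f g zero    = refl
sumBelow-+ f g (suc N) = trans (cong (_+ (f N + g N)) (sumBelow-+ f g N))
                               (interchange (sumBelow f N) (sumBelow g N) (f N) (g N))

sumBelow-zero : ∀ {f} N → (∀ {i} → i < N → f i ≡ 0) → sumBelow f N ≡ 0
sumBelow-zero zero    f≗0 = refl
sumBelow-zero (suc N) f≗0 =
  cong₂ _+_ (sumBelow-zero N (λ i<N → f≗0 (m<n⇒m<1+n i<N))) (f≗0 ≤-refl)

sumBelow-single : ∀ {f} N {j} → j < N → (∀ {i} → i < N → i ≢ j → f i ≡ 0) →
  sumBelow f N ≡ f j
sumBelow-single {f} (suc N) {j} j<1+N f≗0 with N ≟ j
... | yes refl = cong (_+ f N) (sumBelow-zero N (λ i<N → f≗0 (m<n⇒m<1+n i<N) (<⇒≢ i<N)))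
... | no  N≢j  = begin
  sumBelow f N + f N ≡⟨ cong₂ _+_ (sumBelow-single N j<N (λ i<N → f≗0 (m<n⇒m<1+n i<N)))
                                  (f≗0 ≤-refl N≢j) ⟩
  f j + 0            ≡⟨ +-identityʳ (f j) ⟩
  f j                ∎
  where
  open ≡-Reasoning
  j<N : j < N
  j<N = ≤∧≢⇒< (s≤s⁻¹ j<1+N) (λ j≡N → N≢j (sym j≡N))

xPow-diag : ∀ n → xPow n n ≡ 1
xPow-diag n = if-yes (n ≟ n) refl

xPow-off : ∀ n i → i ≢ n → xPow n i ≡ 0
xPow-off n i = if-no (i ≟ n)

shift : ℕ → Poly → Poly
shift s f i = if ⌊ s ≤? i ⌋ then f (i ∸ s) else 0

shift-≤ : ∀ {s i} f → s ≤ i → shift s f i ≡ f (i ∸ s)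
shift-≤ {s} {i} f = if-yes (s ≤? i)

shift-> : ∀ {s i} f → i < s → shift s f i ≡ 0
shift-> {s} {i} f i<s = if-no (s ≤? i) (<⇒≱ i<s)

shift-+ : ∀ s f t → shift s f (s + t) ≡ f t
shift-+ s f t = trans (shift-≤ f (m≤m+n s t)) (cong f (m+n∸m≡n s t))

shift-support : ∀ {s i} f → shift s f i ≢ 0 → Σ ℕ λ t → i ≡ s + t × f t ≢ 0
shift-support {s} {i} f nz with s ≤? i
... | yes s≤i = i ∸ s , sym (m+[n∸m]≡n s≤i) , nz
... | no  _   = contradiction refl nz

mulP-xPowˡ : ∀ s f i → mulP (xPow s) f i ≡ shift s f i
mulP-xPowˡ s f i with s ≤? i
... | yes s≤i = begin
  mulP (xPow s) f i     ≡⟨ sumBelow-single (suc i) (s≤s s≤i)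
                             (λ {u} _ u≢s → cong (_* f (i ∸ u)) (xPow-off s u u≢s)) ⟩
  xPow s s * f (i ∸ s)  ≡⟨ cong (_* f (i ∸ s)) (xPow-diag s) ⟩
  1 * f (i ∸ s)         ≡⟨ *-identityˡ _ ⟩
  f (i ∸ s)             ∎
  where open ≡-Reasoning
... | no s≰i = sumBelow-zero (suc i) (λ {u} u<1+i →
                 cong (_* f (i ∸ u)) (xPow-off s u (λ { refl → s≰i (s≤s⁻¹ u<1+i) })))

mulP-xPowʳ : ∀ f s i → mulP f (xPow s) i ≡ shift s f i
mulP-xPowʳ f s i with s ≤? i
... | yes s≤i = begin
  mulP f (xPow s) i               ≡⟨ sumBelow-single (suc i) (s≤s (m∸n≤m i s)) off ⟩
  f (i ∸ s) * xPow s (i ∸ (i ∸ s)) ≡⟨ cong (λ u → f (i ∸ s) * xPow s u) (m∸[m∸n]≡n s≤i) ⟩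
  f (i ∸ s) * xPow s s            ≡⟨ cong (f (i ∸ s) *_) (xPow-diag s) ⟩
  f (i ∸ s) * 1                   ≡⟨ *-identityʳ _ ⟩
  f (i ∸ s)                       ∎
  where
  open ≡-Reasoning
  off : ∀ {u} → u < suc i → u ≢ i ∸ s → f u * xPow s (i ∸ u) ≡ 0
  off {u} u<1+i u≢ = trans (cong (f u *_) (xPow-off s (i ∸ u) λ eq →
      u≢ (trans (sym (m∸[m∸n]≡n (s≤s⁻¹ u<1+i))) (cong (i ∸_) eq)))) (*-zeroʳ (f u))
... | no s≰i = sumBelow-zero (suc i) (λ {u} _ → trans (cong (f u *_)
                 (xPow-off s (i ∸ u) (λ eq → s≰i (subst (_≤ i) eq (m∸n≤m i u))))) (*-zeroʳ (f u)))

module BinomialPowers (F : Poly) (D E : ℕ) (F-binomial : ∀ u → F u ≡ xPow D u + xPow E u) where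

  powP-suc : ∀ j X → powP F (suc j) X ≡ shift D (powP F j) X + shift E (powP F j) X
  powP-suc j X = begin
    sumBelow (λ u → F u * G (X ∸ u)) (suc X)
      ≡⟨ sumBelow-cong (suc X) (λ {u} _ → trans (cong (_* G (X ∸ u)) (F-binomial u))
                                                (*-distribʳ-+ (G (X ∸ u)) (xPow D u) (xPow E u))) ⟩
    sumBelow (λ u → xPow D u * G (X ∸ u) + xPow E u * G (X ∸ u)) (suc X)
      ≡⟨ sumBelow-+ _ _ (suc X) ⟩
    mulP (xPow D) G X + mulP (xPow E) G X
      ≡⟨ cong₂ _+_ (mulP-xPowˡ D G X) (mulP-xPowˡ E G X) ⟩
    shift D G X + shift E G X ∎
    where
    open ≡-Reasoning
    G : Poly
    G = powP F j

  powP-support : ∀ j X → powP F j X ≢ 0 → ∃₂ λ i w → i + w ≡ j × X ≡ i * D + w * E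
  powP-support zero X nz with X ≟ 0
  ... | yes X≡0 = 0 , 0 , refl , X≡0
  ... | no  _   = contradiction refl nz
  powP-support (suc j) X nz with shift D (powP F j) X ≟ 0 | shift E (powP F j) X ≟ 0
  ... | yes zD | yes zE = contradiction (trans (powP-suc j X) (cong₂ _+_ zD zE)) nz
  ... | no nzD | _ with shift-support (powP F j) nzD
  ...   | t , refl , nz′ with powP-support j t nz′
  ...     | i , w , refl , refl = suc i , w , refl , sym (+-assoc D (i * D) (w * E))
  powP-support (suc j) X nz | yes _ | no nzE with shift-support (powP F j) nzE
  ...   | t , refl , nz′ with powP-support j t nz′
  ...     | i , w , refl , refl = i , suc w , +-suc i w , x∙yz≈y∙xz E (i * D) (w * E)

  module _ (E<D : E < D) where

    powP-above : ∀ j X → j * D < X → powP F j X ≡ 0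
    powP-above j X jD<X with powP F j X ≟ 0
    ... | yes z = z
    ... | no nz with powP-support j X nz
    ...   | i , w , refl , refl = contradiction jD<X (≤⇒≯ (begin
      i * D + w * E ≤⟨ +-monoʳ-≤ (i * D) (*-monoʳ-≤ w (<⇒≤ E<D)) ⟩
      i * D + w * D ≡⟨ *-distribʳ-+ D i w ⟨
      (i + w) * D   ∎))
      where open ≤-Reasoning

    powP-top : ∀ j → powP F j (j * D) ≡ 1
    powP-top zero    = refl
    powP-top (suc j) = begin
      powP F (suc j) (D + j * D)                                          ≡⟨ powP-suc j _ ⟩
      shift D (powP F j) (D + j * D) + shift E (powP F j) (D + j * D)     ≡⟨ cong₂ _+_ top lower ⟩
      1 + 0                                                               ∎
      where
      open ≡-Reasoning
      top : shift D (powP F j) (D + j * D) ≡ 1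
      top = trans (shift-+ D (powP F j) (j * D)) (powP-top j)
      lower : shift E (powP F j) (D + j * D) ≡ 0
      lower = trans (shift-≤ (powP F j) (≤-trans (<⇒≤ E<D) (m≤m+n D (j * D))))
                    (powP-above j _ (subst (j * D <_) (sym (+-∸-comm (j * D) (<⇒≤ E<D)))
                                            (m<n+m (j * D) (m<n⇒0<n∸m E<D))))

    shift-D-next : ∀ j → shift D (powP F j) (j * D + E) ≡ j
    powP-next : ∀ j → powP F (suc j) (j * D + E) ≡ suc j

    shift-D-next zero    = shift-> (powP F zero) E<D
    shift-D-next (suc j) = trans (cong (shift D (powP F (suc j))) (+-assoc D (j * D) E))
                                 (trans (shift-+ D (powP F (suc j)) (j * D + E)) (powP-next j))

    powP-next j = begin
      powP F (suc j) (j * D + E)                                          ≡⟨ powP-suc j _ ⟩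
      shift D (powP F j) (j * D + E) + shift E (powP F j) (j * D + E)
        ≡⟨ cong₂ _+_ (shift-D-next j) top ⟩
      j + 1                                                               ≡⟨ +-comm j 1 ⟩
      suc j                                                               ∎
      where
      open ≡-Reasoning
      top : shift E (powP F j) (j * D + E) ≡ 1
      top = trans (cong (shift E (powP F j)) (+-comm (j * D) E))
                  (trans (shift-+ E (powP F j) (j * D)) (powP-top j))

-- The Cartier operator

negF-binomial : ∀ p → dd p / 2 + p ≢ dd p →
  ∀ u → negF p u ≡ xPow (dd p) u + xPow (dd p / 2 + p) u
negF-binomial p e≢d u with u ≟ dd p | u ≟ dd p / 2 + p
... | yes u≡d | yes u≡e = contradiction (trans (sym u≡e) u≡d) e≢d
... | yes _   | no  _   = refl
... | no  _   | yes _   = refl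
... | no  _   | no  _   = refl

cartier-coefficient : ∀ {p m n a b T} → a ≤ m → p * b + (p ∸ 1) ≡ n + T →
  cartier p m n a b ≡ (m C a) * powP (negF p) (m ∸ a) T
cartier-coefficient {p} {m} {n} {a} {b} {T} a≤m exponent = begin
  cartier p m n a b                                   ≡⟨ if-yes (a ≤? m) a≤m ⟩
  (m C a) * mulP G (xPow n) (p * b + (p ∸ 1))         ≡⟨ cong (λ X → (m C a) * mulP G (xPow n) X) exponent ⟩
  (m C a) * mulP G (xPow n) (n + T)                   ≡⟨ cong ((m C a) *_) (mulP-xPowʳ G n (n + T)) ⟩
  (m C a) * shift n G (n + T)                         ≡⟨ cong ((m C a) *_) (shift-+ n G T) ⟩
  (m C a) * G T                                       ∎
  where
  open ≡-Reasoning
  G : Poly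
  G = powP (negF p) (m ∸ a)

cartier-support : ∀ {p m n a b} → cartier p m n a b ≢ 0 →
  a ≤ m × Σ ℕ λ T → p * b + (p ∸ 1) ≡ n + T × powP (negF p) (m ∸ a) T ≢ 0
cartier-support {p} {m} {n} {a} {b} nz with a ≤? m
... | no  _   = contradiction refl nz
... | yes a≤m = a≤m , shift-support G shift≢0
  where
  G : Poly
  G = powP (negF p) (m ∸ a)
  shift≢0 : shift n G (p * b + (p ∸ 1)) ≢ 0
  shift≢0 z = nz (trans (cong ((m C a) *_) (trans (mulP-xPowʳ G n _) z)) (*-zeroʳ (m C a)))

prime∤! : ∀ {p m} → Prime p → m < p → ¬ p ∣ m !
prime∤! {m = zero}  p-prime _   p∣1 = nonTrivial⇒≢1 {{prime⇒nonTrivial p-prime}} (∣1⇒≡1 p∣1)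
prime∤! {m = suc m} p-prime m<p p∣ with euclidsLemma (suc m) (m !) p-prime p∣
... | inj₁ p∣1+m = <⇒≱ m<p (∣⇒≤ p∣1+m)
... | inj₂ p∣m!  = prime∤! p-prime (<⇒≤ m<p) p∣m!

prime∤C : ∀ {p m k} → Prime p → m < p → k ≤ m → ¬ p ∣ m C k
prime∤C {p} {m} {k} p-prime m<p k≤m p∣C =
  prime∤! p-prime m<p (subst (p ∣_) C*k![m∸k]!≡m! (∣m⇒∣m*n _ p∣C))
  where
  instance
    _ : NonZero (k ! * (m ∸ k) !)
    _ = m*n≢0 (k !) ((m ∸ k) !) {{k !≢0}} {{(m ∸ k) !≢0}}
  C*k![m∸k]!≡m! : (m C k) * (k ! * (m ∸ k) !) ≡ m !
  C*k![m∸k]!≡m! = trans (cong (_* (k ! * (m ∸ k) !)) (nCk≡n!/k![n-k]! k≤m))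
                        (m/n*n≡m (k![n∸k]!∣n! k≤m))

-- Arithmetic of the exponents

m+o≡n⇒m≤n : ∀ {m n} o → m + o ≡ n → m ≤ n
m+o≡n⇒m≤n {m} o refl = m≤m+n m o

remainder-unique : ∀ {q a c x y} .{{_ : NonZero q}} → a < q → c < q →
  a + x * q ≡ c + y * q → a ≡ c
remainder-unique {q} {a} {c} {x} {y} a<q c<q eq = begin
  a               ≡⟨ m<n⇒m%n≡m a<q ⟨
  a % q           ≡⟨ [m+kn]%n≡m%n a x q ⟨
  (a + x * q) % q ≡⟨ cong (_% q) eq ⟩
  (c + y * q) % q ≡⟨ [m+kn]%n≡m%n c y q ⟩
  c % q           ≡⟨ m<n⇒m%n≡m c<q ⟩
  c               ∎
  where open ≡-Reasoning

2*i+w≤2*[i+w] : ∀ i w → 2 * i + w ≤ 2 * (i + w)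
2*i+w≤2*[i+w] i w = m+o≡n⇒m≤n w (solve (i ∷ w ∷ []))

2*+-unique : ∀ {i w i₀ w₀} → w₀ ≤ 1 → i + w ≤ i₀ + w₀ → 2 * i + w ≡ 2 * i₀ + w₀ →
  i ≡ i₀ × w ≡ w₀
2*+-unique {i} {w} {i₀} {w₀} w₀≤1 i+w≤ eq = cases w≤w₀ w₀≤1 eq
  where
  w≤w₀ : w ≤ w₀
  w≤w₀ = +-cancelˡ-≤ (2 * i + w) w w₀ (begin
    2 * i + w + w       ≡⟨ solve (i ∷ w ∷ []) ⟩
    2 * (i + w)         ≤⟨ *-monoʳ-≤ 2 i+w≤ ⟩
    2 * (i₀ + w₀)       ≡⟨ solve (i₀ ∷ w₀ ∷ []) ⟩
    2 * i₀ + w₀ + w₀    ≡⟨ cong (_+ w₀) eq ⟨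
    2 * i + w + w₀      ∎)
    where open ≤-Reasoning
  cases : ∀ {w w₀} → w ≤ w₀ → w₀ ≤ 1 → 2 * i + w ≡ 2 * i₀ + w₀ → i ≡ i₀ × w ≡ w₀
  cases {0} {0} _ _ eq =
    *-cancelˡ-≡ i i₀ 2 (trans (sym (+-identityʳ (2 * i))) (trans eq (+-identityʳ (2 * i₀)))) , refl
  cases {0} {1} _ _ eq =
    contradiction (trans (sym (+-identityʳ (2 * i))) (trans eq (+-comm (2 * i₀) 1))) (even≢odd i i₀)
  cases {1} {1} _ _ eq = *-cancelˡ-≡ i i₀ 2 (+-cancelʳ-≡ 1 (2 * i) (2 * i₀) eq) , refl
  cases {suc _} {0} () _ _
  cases {2+ _} {1} (s≤s ()) _ _
  cases {_} {2+ _} _ (s≤s ()) _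

-- d ≡ 1 and 2e ≡ 1 modulo p.
exponent-residue : ∀ {p e} → 2 * e ≡ dd p + 2 * p → ∀ i w →
  2 * (i * dd p + w * e) ≡ (2 * i + w) + (2 * i * p + w * (p + 2)) * p
exponent-residue {p} {e} 2e≡ i w = begin
  2 * (i * (p * p + 1) + w * e)                   ≡⟨ solve (p ∷ e ∷ i ∷ w ∷ []) ⟩
  2 * i * (p * p + 1) + w * (2 * e)               ≡⟨ cong (λ x → 2 * i * (p * p + 1) + w * x) 2e≡ ⟩
  2 * i * (p * p + 1) + w * ((p * p + 1) + 2 * p) ≡⟨ solve (p ∷ i ∷ w ∷ []) ⟩
  (2 * i + w) + (2 * i * p + w * (p + 2)) * p     ∎
  where open ≡-Reasoning

exponent-rigidity : ∀ {p e i w i₀ w₀ b l} → 2 * e ≡ dd p + 2 * p →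
  w₀ ≤ 1 → i + w ≤ i₀ + w₀ → 2 * (i₀ + w₀) < p →
  p * b + (i₀ * dd p + w₀ * e) ≡ p * l + (i * dd p + w * e) →
  i ≡ i₀ × w ≡ w₀ × b ≡ l
exponent-rigidity {p} {e} {i} {w} {i₀} {w₀} {b} {l} 2e≡ w₀≤1 i+w≤ 2j<p eq = i≡i₀ , w≡w₀ , b≡l
  where
  instance
    _ : NonZero p
    _ = >-nonZero (≤-<-trans z≤n 2j<p)
  2i₀+w₀<p : 2 * i₀ + w₀ < p
  2i₀+w₀<p = ≤-<-trans (2*i+w≤2*[i+w] i₀ w₀) 2j<p
  2i+w<p : 2 * i + w < p
  2i+w<p = ≤-<-trans (≤-trans (2*i+w≤2*[i+w] i w) (*-monoʳ-≤ 2 i+w≤)) 2j<p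
  X₀ X : ℕ
  X₀ = 2 * b + (2 * i₀ * p + w₀ * (p + 2))
  X  = 2 * l + (2 * i * p + w * (p + 2))
  residues : (2 * i₀ + w₀) + X₀ * p ≡ (2 * i + w) + X * p
  residues = begin
    (2 * i₀ + w₀) + (2 * b + (2 * i₀ * p + w₀ * (p + 2))) * p
      ≡⟨ solve (p ∷ b ∷ i₀ ∷ w₀ ∷ []) ⟩
    2 * (p * b) + ((2 * i₀ + w₀) + (2 * i₀ * p + w₀ * (p + 2)) * p)
      ≡⟨ cong (2 * (p * b) +_) (exponent-residue 2e≡ i₀ w₀) ⟨
    2 * (p * b) + 2 * (i₀ * dd p + w₀ * e)
      ≡⟨ *-distribˡ-+ 2 (p * b) _ ⟨
    2 * (p * b + (i₀ * dd p + w₀ * e))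
      ≡⟨ cong (2 *_) eq ⟩
    2 * (p * l + (i * dd p + w * e))
      ≡⟨ *-distribˡ-+ 2 (p * l) _ ⟩
    2 * (p * l) + 2 * (i * dd p + w * e)
      ≡⟨ cong (2 * (p * l) +_) (exponent-residue 2e≡ i w) ⟩
    2 * (p * l) + ((2 * i + w) + (2 * i * p + w * (p + 2)) * p)
      ≡⟨ solve (p ∷ l ∷ i ∷ w ∷ []) ⟩
    (2 * i + w) + (2 * l + (2 * i * p + w * (p + 2))) * p ∎
    where open ≡-Reasoning
  i≡i₀×w≡w₀ : i ≡ i₀ × w ≡ w₀
  i≡i₀×w≡w₀ = 2*+-unique w₀≤1 i+w≤
                 (sym (remainder-unique {x = X₀} {y = X} 2i₀+w₀<p 2i+w<p residues))
  i≡i₀ : i ≡ i₀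
  i≡i₀ = proj₁ i≡i₀×w≡w₀
  w≡w₀ : w ≡ w₀
  w≡w₀ = proj₂ i≡i₀×w≡w₀
  b≡l : b ≡ l
  b≡l = *-cancelˡ-≡ b l p (+-cancelʳ-≡ _ (p * b) (p * l)
          (trans eq (cong₂ (λ i w → p * l + (i * dd p + w * e)) i≡i₀ w≡w₀)))

module _ {p d g l : ℕ} (bound : 2 * p * l ≤ d * (1 + 2 * g)) where

  private
    doubled : 2 * (p * l + p) ≤ d * (1 + 2 * g) + 2 * p
    doubled = begin
      2 * (p * l + p)         ≡⟨ solve (p ∷ l ∷ []) ⟩
      2 * p * l + 2 * p       ≤⟨ +-monoˡ-≤ (2 * p) bound ⟩
      d * (1 + 2 * g) + 2 * p ∎
      where open ≤-Reasoning

  quotient≤ : ∀ {J} → 2 * p < d → J * d < p * l + p → J ≤ g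
  quotient≤ {J} 2p<d Jd< = s≤s⁻¹ (*-cancelʳ-< d J (suc g) (*-cancelˡ-< 2 _ _ (begin-strict
    2 * (J * d)             <⟨ *-monoʳ-< 2 Jd< ⟩
    2 * (p * l + p)         ≤⟨ doubled ⟩
    d * (1 + 2 * g) + 2 * p <⟨ +-monoʳ-< (d * (1 + 2 * g)) 2p<d ⟩
    d * (1 + 2 * g) + d     ≡⟨ solve (d ∷ g ∷ []) ⟩
    2 * (suc g * d)         ∎)))
    where open ≤-Reasoning

  quotient< : ∀ {e J} → 2 * e ≡ d + 2 * p → e + J * d < p * l + p → J < g
  quotient< {e} {J} 2e≡ eJd< =
    *-cancelʳ-< d J g (*-cancelˡ-< 2 _ _ (+-cancelʳ-< (d + 2 * p) _ _ (begin-strict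
    2 * (J * d) + (d + 2 * p) ≡⟨ cong (2 * (J * d) +_) 2e≡ ⟨
    2 * (J * d) + 2 * e       ≡⟨ solve (J ∷ d ∷ e ∷ []) ⟩
    2 * (e + J * d)           <⟨ *-monoʳ-< 2 eJd< ⟩
    2 * (p * l + p)           ≤⟨ doubled ⟩
    d * (1 + 2 * g) + 2 * p   ≡⟨ solve (d ∷ g ∷ p ∷ []) ⟩
    2 * (g * d) + (d + 2 * p) ∎)))
    where open ≤-Reasoning

-- Needed when J = g, where r < e alone does not bound r enough for the basis.
integrality : ∀ {p c l q} → c < p → c * p ≡ 1 + 2 * q → 2 * p * l ≤ dd p * c → 2 * l < c * p
integrality {p} {c} {l} {q} c<p cp-odd bound with 2 * l <? c * p
... | yes 2l<cp = 2l<cp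
... | no  2l≮cp = contradiction c<p (≤⇒≯ p≤c)
  where
  cp<2l : c * p < 2 * l
  cp<2l = ≤∧≢⇒< (≮⇒≥ 2l≮cp) (λ cp≡2l → even≢odd l q (trans (sym cp≡2l) cp-odd))
  p≤c : p ≤ c
  p≤c = +-cancelˡ-≤ (p * (c * p)) p c (begin
    p * (c * p) + p     ≡⟨ solve (p ∷ c ∷ []) ⟩
    p * (1 + c * p)     ≤⟨ *-monoʳ-≤ p cp<2l ⟩
    p * (2 * l)         ≡⟨ solve (p ∷ l ∷ []) ⟩
    2 * p * l           ≤⟨ bound ⟩
    (p * p + 1) * c     ≡⟨ solve (p ∷ c ∷ []) ⟩
    p * (c * p) + c     ∎)
    where open ≤-Reasoning

tight-bound : ∀ {p g l r} → r + g * dd p < p * l + p → 2 * l < (1 + 2 * g) * p →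
  2 * ((1 + r) * p) < (p + 1) * dd p
tight-bound {p} {g} {l} {r} r+gd< 2l< = begin-strict
  2 * ((1 + r) * p)         ≡⟨ *-assoc 2 (1 + r) p ⟨
  2 * (1 + r) * p           ≤⟨ *-monoˡ-≤ p 2[1+r]≤ ⟩
  (p + 1) * p * p           <⟨ m+o≡n⇒m≤n p (solve (p ∷ [])) ⟩
  (p + 1) * (p * p + 1)     ∎
  where
  open ≤-Reasoning
  2[1+r]≤ : 2 * (1 + r) ≤ (p + 1) * p
  2[1+r]≤ = +-cancelʳ-≤ (2 * (g * dd p)) _ _ (begin
    2 * (1 + r) + 2 * (g * (p * p + 1))   ≡⟨ solve (r ∷ g ∷ p ∷ []) ⟩
    2 * (1 + (r + g * (p * p + 1)))       ≤⟨ *-monoʳ-≤ 2 r+gd< ⟩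
    2 * (p * l + p)                       ≡⟨ solve (p ∷ l ∷ []) ⟩
    p * ((1 + 2 * l) + 1)                 ≤⟨ *-monoʳ-≤ p (+-monoˡ-≤ 1 2l<) ⟩
    p * ((1 + 2 * g) * p + 1)             ≡⟨ solve (p ∷ g ∷ []) ⟩
    (p + 1) * p + 2 * (g * (p * p))
      ≤⟨ +-monoʳ-≤ ((p + 1) * p) (*-monoʳ-≤ 2 (*-monoʳ-≤ g (m≤m+n (p * p) 1))) ⟩
    (p + 1) * p + 2 * (g * (p * p + 1))   ∎)

loose-bound : ∀ {p e r} → r < e → 2 * e ≡ dd p + 2 * p → 2 * ((1 + r) * p) < (p + 3) * dd p
loose-bound {p} {e} {r} r<e 2e≡ = begin-strict
  2 * ((1 + r) * p)           ≡⟨ *-assoc 2 (1 + r) p ⟨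
  2 * (1 + r) * p             ≤⟨ *-monoˡ-≤ p (*-monoʳ-≤ 2 r<e) ⟩
  2 * e * p                   ≡⟨ cong (_* p) 2e≡ ⟩
  ((p * p + 1) + 2 * p) * p   <⟨ m+o≡n⇒m≤n (p * p + 2) (solve (p ∷ [])) ⟩
  (p + 3) * (p * p + 1)       ∎
  where open ≤-Reasoning

odd-bound : ∀ {p d e n} → n + e < d → 2 * e ≡ d + 2 * p → 2 * ((1 + n) * p) < (p + 1) * d
odd-bound {p} {d} {e} {n} n+e<d 2e≡ = begin-strict
  2 * ((1 + n) * p)   ≡⟨ *-assoc 2 (1 + n) p ⟨
  2 * (1 + n) * p     ≤⟨ *-monoˡ-≤ p 2[1+n]≤d ⟩
  d * p               <⟨ m<m+n (d * p) (≤-<-trans z≤n n+e<d) ⟩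
  d * p + d           ≡⟨ solve (p ∷ d ∷ []) ⟩
  (p + 1) * d         ∎
  where
  open ≤-Reasoning
  2[1+n]≤d : 2 * (1 + n) ≤ d
  2[1+n]≤d = m+n≤o⇒m≤o (2 * (1 + n)) (+-cancelʳ-≤ d _ _ (begin
    2 * (1 + n) + 2 * p + d   ≡⟨ solve (n ∷ p ∷ d ∷ []) ⟩
    2 * (1 + n) + (d + 2 * p) ≡⟨ cong (2 * (1 + n) +_) 2e≡ ⟨
    2 * (1 + n) + 2 * e       ≡⟨ solve (n ∷ e ∷ []) ⟩
    2 * (1 + (n + e))         ≤⟨ *-monoʳ-≤ 2 n+e<d ⟩
    2 * d                     ≡⟨ solve (d ∷ []) ⟩
    d + d                     ∎))

inBasis-intro : ∀ {q m n} → m ≤ suc q ∸ 2 → (1 + n) * suc q < (suc q ∸ m ∸ 1) * dd (suc q) →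
  InBasis (suc q) m n
inBasis-intro {q} {m} {n} m≤ lt = m≤ , (begin
  n + 2                    ≡⟨ m*n/n≡m (n + 2) (suc q) ⟨
  (n + 2) * suc q / suc q  ≤⟨ /-monoˡ-≤ (suc q) (begin
      (n + 2) * suc q             ≡⟨ solve (n ∷ q ∷ []) ⟩
      suc ((1 + n) * suc q) + q   ≤⟨ +-monoˡ-≤ q lt ⟩
      (suc q ∸ m ∸ 1) * dd (suc q) + q ∎) ⟩
  ((suc q ∸ m ∸ 1) * dd (suc q) + q) / suc q ∎)
  where open ≤-Reasoning

inBasis-odd : ∀ {s m n c} → m + c < s →
  2 * ((1 + n) * (1 + 2 * s)) < ((1 + 2 * s) + (1 + 2 * c)) * dd (1 + 2 * s) →
  InBasis (1 + 2 * s) m n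
inBasis-odd {s} {m} {n} {c} m+c<s lt = inBasis-intro m≤p∸2 (begin-strict
  (1 + n) * p       <⟨ *-cancelˡ-< 2 _ _ (subst (2 * ((1 + n) * p) <_) (doubled (dd p)) lt) ⟩
  (s + suc c) * dd p ≤⟨ *-monoˡ-≤ (dd p) s+1+c≤ ⟩
  (p ∸ m ∸ 1) * dd p ∎)
  where
  open ≤-Reasoning
  p : ℕ
  p = 1 + 2 * s
  doubled : ∀ x → ((1 + 2 * s) + (1 + 2 * c)) * x ≡ 2 * ((s + suc c) * x)
  doubled x = solve (s ∷ c ∷ x ∷ [])
  m<s : m < s
  m<s = ≤-<-trans (m≤m+n m c) m+c<s
  m≤p∸2 : m ≤ p ∸ 2
  m≤p∸2 = m+n≤o⇒m≤o∸n m (begin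
    m + 1   ≡⟨ +-comm m 1 ⟩
    suc m   ≤⟨ m<s ⟩
    s       ≤⟨ m≤m+n s (s + 0) ⟩
    2 * s   ∎)
  s+1+c≤ : s + suc c ≤ p ∸ m ∸ 1
  s+1+c≤ = subst (s + suc c ≤_) (sym (∸-+-assoc p m 1)) (m+n≤o⇒m≤o∸n (s + suc c) (begin
    s + suc c + (m + 1)   ≡⟨ solve (s ∷ c ∷ m ∷ []) ⟩
    suc (s + suc (m + c)) ≤⟨ s≤s (+-monoʳ-≤ s m+c<s) ⟩
    suc (s + s)           ≡⟨ solve (s ∷ []) ⟩
    1 + 2 * s             ∎))

+-cross-cancel : ∀ {a b c n x y} → a + c ≡ n + x → b + c ≡ n + y → a + y ≡ b + x
+-cross-cancel {a} {b} {c} {n} {x} {y} eqa eqb = +-cancelʳ-≡ (c + n) (a + y) (b + x) (begin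
  a + y + (c + n)   ≡⟨ solve (a ∷ c ∷ n ∷ y ∷ []) ⟩
  a + c + (n + y)   ≡⟨ cong₂ _+_ eqa (sym eqb) ⟩
  n + x + (b + c)   ≡⟨ solve (n ∷ x ∷ b ∷ c ∷ []) ⟩
  b + x + (c + n)   ∎)
  where open ≡-Reasoning

2∣dd-odd : ∀ s → 2 ∣ dd (1 + 2 * s)
2∣dd-odd s = divides (2 * s * s + 2 * s + 1) (begin
  (1 + 2 * s) * (1 + 2 * s) + 1  ≡⟨ solve (s ∷ []) ⟩
  (2 * s * s + 2 * s + 1) * 2    ∎)
  where open ≡-Reasoning

2*p<dd : ∀ {p} → 3 ≤ p → 2 * p < dd p
2*p<dd {p} 3≤p = begin-strict
  2 * p     <⟨ *-monoˡ-< p {2} {3} ≤-refl ⟩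
  3 * p     ≤⟨ *-monoˡ-≤ p 3≤p ⟩
  p * p     <⟨ m<m+n (p * p) z<s ⟩
  p * p + 1 ∎
  where
  open ≤-Reasoning
  instance
    _ : NonZero p
    _ = >-nonZero (≤-trans (s≤s z≤n) 3≤p)

odd*odd : ∀ a b → (1 + 2 * a) * (1 + 2 * b) ≡ 1 + 2 * (a + b + 2 * a * b)
odd*odd = solve-∀

-- p = 2s + 1 where s = k + g + 1, so g is the slack in 2k < p − 1; −f = x^d + x^e.
module Construction (k g l : ℕ) where

  s p d e N : ℕ
  s = suc (k + g)
  p = 1 + 2 * s
  d = dd p
  e = dd p / 2 + p
  N = p * l + (p ∸ 1)

  LargestTermWitness : Set
  LargestTermWitness =
    Σ ℕ λ m → Σ ℕ λ n → InBasis p m n × (2 * m < p ∸ 1) × LargestTerm p (cartier p m n) k l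

  2e≡d+2p : 2 * e ≡ d + 2 * p
  2e≡d+2p = trans (*-distribˡ-+ 2 (dd p / 2) p)
                  (cong (_+ 2 * p) (trans (*-comm 2 (dd p / 2)) (m/n*n≡m (2∣dd-odd s))))

  2p<d : 2 * p < d
  2p<d = 2*p<dd (s≤s (*-monoʳ-≤ 2 (s≤s z≤n)))

  e<d : e < d
  e<d = *-cancelˡ-< 2 e d (begin-strict
    2 * e     ≡⟨ 2e≡d+2p ⟩
    d + 2 * p <⟨ +-monoʳ-< d 2p<d ⟩
    d + d     ≡⟨ cong (d +_) (+-identityʳ d) ⟨
    2 * d     ∎)
    where open ≤-Reasoning

  open BinomialPowers (negF p) d e (negF-binomial p (<⇒≢ e<d))

  j≤g⇒2j<p : ∀ {j} → j ≤ g → 2 * j < p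
  j≤g⇒2j<p j≤g = s≤s (*-monoʳ-≤ 2 (≤-trans j≤g (m≤n+m g (suc k))))

  module _ (p-prime : Prime p) (bound : 2 * p * l ≤ d * (1 + 2 * g)) where

    top-largestTerm : ∀ {i₀ w₀ j n T} → w₀ ≤ 1 → i₀ + w₀ ≡ j → i₀ * d + w₀ * e ≡ T → j ≤ g →
      N ≡ n + T → ¬ p ∣ powP (negF p) j T → LargestTerm p (cartier p (k + j) n) k l
    top-largestTerm {i₀} {w₀} {j} {n} {T} w₀≤1 refl T≡ j≤g top p∤value = p∤coefficient , maximal
      where
      m : ℕ
      m = k + j
      m<p : m < p
      m<p = <-≤-trans (s≤s (+-monoʳ-≤ k j≤g)) (≤-trans (m≤m+n s (s + 0)) (n≤1+n _))
      coefficient : cartier p m n k l ≡ (m C k) * powP (negF p) j T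
      coefficient = trans (cartier-coefficient {p} {m} {n} {k} {l} {T} (m≤m+n k j) top)
                          (cong (λ x → (m C k) * powP (negF p) x T) (m+n∸m≡n k j))
      p∤coefficient : ¬ p ∣ cartier p m n k l
      p∤coefficient p∣
        with euclidsLemma (m C k) (powP (negF p) j T) p-prime (subst (p ∣_) coefficient p∣)
      ... | inj₁ p∣C = prime∤C p-prime m<p (m≤m+n k j) p∣C
      ... | inj₂ p∣v = p∤value p∣v
      maximal : ∀ a b → ¬ p ∣ cartier p m n a b → LexLeq a b k l
      maximal a b p∤
        with cartier-support {p} {m} {n} {a} {b} (λ z → p∤ (subst (p ∣_) (sym z) (p ∣0)))
      ... | a≤m , T′ , exponent , nz with powP-support (m ∸ a) T′ nz
      ... | i , w , i+w≡ , refl with a <? k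
      ... | yes a<k = inj₁ a<k
      ... | no  a≮k = inj₂ (a≡k , ≤-reflexive (proj₂ (proj₂ rigid)))
        where
        i+w≤j : i + w ≤ i₀ + w₀
        i+w≤j = subst (_≤ j) (sym i+w≡)
                  (≤-trans (∸-monoʳ-≤ m (≮⇒≥ a≮k)) (≤-reflexive (m+n∸m≡n k j)))
        crossed : p * b + (i₀ * d + w₀ * e) ≡ p * l + (i * d + w * e)
        crossed = trans (cong (p * b +_) T≡)
                        (+-cross-cancel {p * b} {p * l} {p ∸ 1} {n} exponent top)
        rigid : i ≡ i₀ × w ≡ w₀ × b ≡ l
        rigid = exponent-rigidity 2e≡d+2p w₀≤1 i+w≤j (j≤g⇒2j<p j≤g) crossed
        a≡k : a ≡ k
        a≡k = ∸-cancelˡ-≡ {n = a} {m = m} {o = k} a≤m (m≤m+n k j) (begin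
          m ∸ a    ≡⟨ i+w≡ ⟨
          i + w    ≡⟨ cong₂ _+_ (proj₁ rigid) (proj₁ (proj₂ rigid)) ⟩
          j        ≡⟨ m+n∸m≡n k j ⟨
          m ∸ k    ∎)
          where open ≡-Reasoning

    witness : ∀ {i₀ w₀ j c n T} → w₀ ≤ 1 → i₀ + w₀ ≡ j → i₀ * d + w₀ * e ≡ T → c + j ≤ g →
      N ≡ n + T → ¬ p ∣ powP (negF p) j T → 2 * ((1 + n) * p) < (p + (1 + 2 * c)) * d →
      LargestTermWitness
    witness {j = j} {c} {n} w₀≤1 i₀+w₀≡j T≡ c+j≤g top p∤value basis-bound =
      k + j , n , inBasis-odd k+j+c<s basis-bound , *-monoʳ-< 2 k+j<s ,
      top-largestTerm w₀≤1 i₀+w₀≡j T≡ j≤g top p∤value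
      where
      j≤g : j ≤ g
      j≤g = ≤-trans (m≤n+m j c) c+j≤g
      k+j+c<s : k + j + c < s
      k+j+c<s = s≤s (subst (_≤ k + g) (sym (+-assoc k j c))
                           (+-monoʳ-≤ k (subst (_≤ g) (+-comm c j) c+j≤g)))
      k+j<s : k + j < s
      k+j<s = s≤s (+-monoʳ-≤ k j≤g)

    J r : ℕ
    J = N / d
    r = N % d

    N≡r+Jd : N ≡ r + J * d
    N≡r+Jd = m≡m%n+[m/n]*n N d

    N<pl+p : N < p * l + p
    N<pl+p = +-monoʳ-< (p * l) ≤-refl

    J≤g : J ≤ g
    J≤g = quotient≤ {p} {d} {g} {l} bound 2p<d (begin-strict
      J * d      ≤⟨ m≤n+m (J * d) r ⟩
      r + J * d  ≡⟨ N≡r+Jd ⟨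
      N          <⟨ N<pl+p ⟩
      p * l + p  ∎)
      where open ≤-Reasoning

    witness-J : ∀ {c} → c + J ≤ g → 2 * ((1 + r) * p) < (p + (1 + 2 * c)) * d → LargestTermWitness
    witness-J {c} c+J≤g =
      witness {J} {0} {J} {c} {r} {J * d} z≤n (+-identityʳ J) (+-identityʳ (J * d)) c+J≤g N≡r+Jd
              (subst (λ x → ¬ p ∣ x) (sym (powP-top e<d J)) (>⇒∤ (s≤s (s≤s z≤n))))

    even-case : r < e → LargestTermWitness
    even-case r<e with J <? g
    ... | yes J<g = witness-J J<g (loose-bound {p} r<e 2e≡d+2p)
    ... | no  J≮g =
      witness-J (≤-reflexive J≡g) (tight-bound {p} {g} {l} {r} r+gd<pl+p 2l<[1+2g]p)
      where
      J≡g : J ≡ g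
      J≡g = ≤-antisym J≤g (≮⇒≥ J≮g)
      r+gd<pl+p : r + g * d < p * l + p
      r+gd<pl+p =
        subst (λ x → r + x * d < p * l + p) J≡g (subst (_< p * l + p) N≡r+Jd N<pl+p)
      2l<[1+2g]p : 2 * l < (1 + 2 * g) * p
      2l<[1+2g]p = integrality {p} {1 + 2 * g} {l} {g + s + 2 * g * s}
                     (s≤s (*-monoʳ-< 2 (s≤s (m≤n+m g k)))) (odd*odd g s) bound

    odd-case : e ≤ r → LargestTermWitness
    odd-case e≤r = witness {J} {1} {suc J} {0} {r ∸ e} {J * d + e} ≤-refl (+-comm J 1)
                     (cong (J * d +_) (*-identityˡ e)) J<g top p∤next
                     (odd-bound {p} {d} {e} {r ∸ e}
                                (subst (_< d) (sym r∸e+e≡r) (m%n<n N d)) 2e≡d+2p)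
      where
      r∸e+e≡r : r ∸ e + e ≡ r
      r∸e+e≡r = m∸n+n≡m e≤r
      top : N ≡ (r ∸ e) + (J * d + e)
      top = begin
        N                      ≡⟨ N≡r+Jd ⟩
        r + J * d              ≡⟨ cong (_+ J * d) r∸e+e≡r ⟨
        (r ∸ e) + e + J * d    ≡⟨ +-assoc (r ∸ e) e (J * d) ⟩
        (r ∸ e) + (e + J * d)  ≡⟨ cong ((r ∸ e) +_) (+-comm e (J * d)) ⟩
        (r ∸ e) + (J * d + e)  ∎
        where open ≡-Reasoning
      J<g : J < g
      J<g = quotient< {p} {d} {g} {l} bound 2e≡d+2p (begin-strict
        e + J * d  ≤⟨ +-monoˡ-≤ (J * d) e≤r ⟩
        r + J * d  ≡⟨ N≡r+Jd ⟨
        N          <⟨ N<pl+p ⟩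
        p * l + p  ∎)
        where open ≤-Reasoning
      p∤next : ¬ p ∣ powP (negF p) (suc J) (J * d + e)
      p∤next = subst (λ x → ¬ p ∣ x) (sym (powP-next e<d J))
                     (>⇒∤ (≤-<-trans (m≤m+n (suc J) (suc J + 0)) (j≤g⇒2j<p J<g)))

    largestTerm-exists : LargestTermWitness
    largestTerm-exists with r <? e
    ... | yes r<e = even-case r<e
    ... | no  r≮e = odd-case (≮⇒≥ r≮e)

odd-prime : ∀ {p} → Prime p → p ≢ 2 → Σ ℕ λ s → p ≡ 1 + 2 * s
odd-prime {p} p-prime p≢2 with p % 2 | m%n<n p 2 | m≡m%n+[m/n]*n p 2
... | 0      | _              | p≡ with prime⇒irreducible p-prime (divides (p / 2) p≡)
...   | inj₁ ()
...   | inj₂ 2≡p = contradiction (sym 2≡p) p≢2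
odd-prime {p} p-prime p≢2 | 1 | _ | p≡ = p / 2 , trans p≡ (cong suc (*-comm (p / 2) 2))
odd-prime {p} p-prime p≢2 | 2+ _ | s≤s (s≤s ()) | _

p∸2∸2k≡1+2g : ∀ k g → (1 + 2 * suc (k + g)) ∸ 2 ∸ 2 * k ≡ 1 + 2 * g
p∸2∸2k≡1+2g k g = begin
  (1 + 2 * suc (k + g)) ∸ 2 ∸ 2 * k       ≡⟨ cong (λ x → x ∸ 2 ∸ 2 * k) p≡ ⟩
  (2 + (2 * k + (1 + 2 * g))) ∸ 2 ∸ 2 * k ≡⟨ m+n∸m≡n (2 * k) (1 + 2 * g) ⟩
  1 + 2 * g                               ∎
  where
  open ≡-Reasoning
  p≡ : 1 + 2 * suc (k + g) ≡ 2 + (2 * k + (1 + 2 * g))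
  p≡ = solve (k ∷ g ∷ [])

lemma2p8 : (p : ℕ) → Prime p → ¬ (p ≡ 2) →
    (k' l : ℕ) → 2 * k' < p ∸ 1 →
    2 * p * l ≤ dd p * (p ∸ 2 ∸ 2 * k') →
    Σ ℕ (λ m → Σ ℕ (λ n →
      InBasis p m n × (2 * m < p ∸ 1) × LargestTerm p (cartier p m n) k' l))
lemma2p8 p p-prime p≢2 k' l 2k'<p∸1 bound with odd-prime p-prime p≢2
... | s , refl with m≤n⇒∃[o]m+o≡n (*-cancelˡ-< 2 k' s 2k'<p∸1)
...   | g , refl = Construction.largestTerm-exists k' g l p-prime
                     (subst (λ c → 2 * p * l ≤ dd p * c) (p∸2∸2k≡1+2g k' g) bound)
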